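{- For every rational $u$ (so $2-u^2\neq 0$), let $p = 2(u^2+1)$, $q = 3u$, $r = 6u$, $s = 2(2-u^2)$ and $a = \frac{4u^2+1}{8(2-u^2)}$. Then $pq(p^2+q^2) = a\,rs(r^2+s^2)$; equivalently $A=p+q$, $B=r-s$, $C=p-q$, $D=r+s$ satisfy $A^4 + aB^4 = C^4 + aD^4$. -}

module Defs where

open import Data.Rational using (ℚ; _+_; _*_; _-_; NonZero; _÷_)
open import Data.Product using (Σ; _×_)
open import Relation.Binary.PropositionalEquality using (_≡_)

ℚ1 ℚ2 ℚ3 ℚ4 ℚ6 ℚ8 : ℚ
ℚ1 = Data.Rational.1ℚ
ℚ2 = ℚ1 + ℚ1
ℚ3 = ℚ2 + ℚ1
ℚ4 = ℚ2 + ℚ2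
ℚ6 = ℚ3 + ℚ3
ℚ8 = ℚ4 + ℚ4

_^4 : ℚ → ℚ
x ^4 = x * x * x * x

module Params (u : ℚ) where
  p q r s : ℚ
  p = ℚ2 * (u * u + ℚ1)
  q = ℚ3 * u
  r = ℚ6 * u
  s = ℚ2 * (ℚ2 - u * u)

  den : ℚ
  den = ℚ8 * (ℚ2 - u * u)

  num : ℚ
  num = ℚ4 * (u * u) + ℚ1

  a : .{{NonZero den}} → ℚ
  a = num ÷ den

  A B C D : ℚ
  A = p + q
  B = r - s
  C = p - q
  D = r + s

  Claim : Set
  Claim = Σ (NonZero den) λ nz →
            (p * q * (p * p + q * q) ≡ a {{nz}} * (r * s * (r * r + s * s)))
          × (A ^4 + a {{nz}} * B ^4 ≡ C ^4 + a {{nz}} * D ^4)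

-- The theorem is a polynomial identity in u together with one arithmetic fact.
--
-- Arithmetic: the denominator 8(2 - u²) never vanishes on ℚ, because no
-- rational squares to a prime.  This is the classical argument: if m/n is in
-- lowest terms and m² = p·n², then p divides m, hence p divides n, so p is a
-- common divisor of m and n, contradicting coprimality.
--
-- Algebra: with X = 6u(u² + 1)(u² + 4) both sides factor as
--   pq(p² + q²) = (4u² + 1)·X   and   rs(r² + s²) = 8(2 - u²)·X,
-- so pq(p² + q²) = a·rs(r² + s²) for a = (4u² + 1)/(8(2 - u²)).  The second
-- claim follows for every p, q, r, s, w from the identity
--   (p + q)⁴ - (p - q)⁴ = 8pq(p² + q²),
-- applied to (p, q) and to (r, -s).
module Submission where

open import Data.Nat as ℕ using (ℕ; nonTrivial⇒≢1)
open import Data.Nat.Tactic.RingSolver using (solve-∀)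
open import Data.Nat.Properties using (*-comm; *-cancelˡ-≡)
open import Data.Nat.Divisibility using (_∣_; divides)
open import Data.Nat.Coprimality using (Coprime; 1-coprimeTo)
import Data.Nat.Coprimality as Coprimality
open import Data.Nat.Primality using (Prime; euclidsLemma; prime[2]; prime⇒nonTrivial; prime⇒nonZero)
import Data.Integer as ℤ
import Data.Integer.Properties as ℤ
open import Data.Rational
import Data.Rational.Properties as ℚ
import Data.Rational.Unnormalised as ℚᵘ
import Data.Rational.Unnormalised.Properties as ℚᵘ
open import Data.Rational.Solver using (module +-*-Solver)
open import Data.Sum using (reduce)
open import Data.Product using (_,_)
open import Relation.Binary.PropositionalEquality
open import Defs

open +-*-Solver

prime∣square⇒prime∣ : ∀ {p} m → Prime p → p ∣ m ℕ.* m → p ∣ m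
prime∣square⇒prime∣ m p-prime p∣m² = reduce (euclidsLemma m m p-prime p∣m²)

coprime-square≢prime-multiple : ∀ {p} m n → Prime p → Coprime m n →
                                m ℕ.* m ≢ p ℕ.* (n ℕ.* n)
coprime-square≢prime-multiple {p} m n p-prime coprime m²≡pn²
  with prime∣square⇒prime∣ m p-prime (divides (n ℕ.* n) (trans m²≡pn² (*-comm p (n ℕ.* n))))
... | divides k refl =
  nonTrivial⇒≢1 (coprime (divides k refl , p∣n))
  where
  instance
    _ = prime⇒nonZero p-prime
    _ = prime⇒nonTrivial p-prime
  -- m = kp turns m² = pn² into p·(pk²) = p·n², i.e. n² = p·k².
  pk²≡n² : p ℕ.* (k ℕ.* k) ≡ n ℕ.* n
  pk²≡n² = *-cancelˡ-≡ _ _ p (trans (solve-kp k p) m²≡pn²)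
    where
    solve-kp : ∀ k p → p ℕ.* (p ℕ.* (k ℕ.* k)) ≡ k ℕ.* p ℕ.* (k ℕ.* p)
    solve-kp = solve-∀
  p∣n : p ∣ n
  p∣n = prime∣square⇒prime∣ n p-prime (divides (k ℕ.* k) (trans (sym pk²≡n²) (*-comm p (k ℕ.* k))))

prime-ℚ : ℕ → ℚ
prime-ℚ p = mkℚ+ p 1 (Coprimality.sym (1-coprimeTo p))

-- No rational squares to a prime: writing u = m/n in lowest terms, u² = p
-- means |m|² = p·n² over ℕ.
square≢prime : ∀ {p} → Prime p → (u : ℚ) → u * u ≢ prime-ℚ p
square≢prime {p} p-prime u@(mkℚ m n-1 coprime) u²≡p
  with ℚᵘ.≃-trans (ℚᵘ.≃-sym (ℚ.toℚᵘ-homo-* u u)) (ℚ.toℚᵘ-cong u²≡p)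
... | ℚᵘ.*≡* m²≡pn² =
  coprime-square≢prime-multiple ℤ.∣ m ∣ n p-prime
    (Coprimality.recompute coprime) |m|²≡pn²
  where
  n = ℕ.suc n-1
  |m|²≡pn² : ℤ.∣ m ∣ ℕ.* ℤ.∣ m ∣ ≡ p ℕ.* (n ℕ.* n)
  |m|²≡pn² = begin
    ℤ.∣ m ∣ ℕ.* ℤ.∣ m ∣                 ≡⟨ ℤ.abs-* m m ⟨
    ℤ.∣ m ℤ.* m ∣                       ≡⟨ cong ℤ.∣_∣ (ℤ.*-identityʳ (m ℤ.* m)) ⟨
    ℤ.∣ m ℤ.* m ℤ.* ℤ.+ 1 ∣             ≡⟨ cong ℤ.∣_∣ m²≡pn² ⟩
    ℤ.∣ ℤ.+ p ℤ.* ℤ.+ (n ℕ.* n) ∣       ≡⟨ ℤ.abs-* (ℤ.+ p) (ℤ.+ (n ℕ.* n)) ⟩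
    p ℕ.* (n ℕ.* n)                     ∎
    where open ≡-Reasoning

÷-rescale : ∀ n d x .{{_ : NonZero d}} → n * x ≡ (n ÷ d) * (d * x)
÷-rescale n d x = sym (begin
  n * (1/ d) * (d * x)     ≡⟨ ℚ.*-assoc n (1/ d) (d * x) ⟩
  n * (1/ d * (d * x))     ≡⟨ cong (n *_) (ℚ.*-assoc (1/ d) d x) ⟨
  n * (1/ d * d * x)       ≡⟨ cong (λ e → n * (e * x)) (ℚ.*-inverseˡ d) ⟩
  n * (1ℚ * x)             ≡⟨ cong (n *_) (ℚ.*-identityˡ x) ⟩
  n * x                    ∎)
  where open ≡-Reasoning

-- (p + q)⁴ - (p - q)⁴ = 8pq(p² + q²); with (r, -s) in place of (p, q) this
-- gives the weighted form below, valid for every weight w.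
quartic-difference : ∀ p q r s w →
  (p + q) ^4 + w * (r - s) ^4
    ≡ (p - q) ^4 + w * (r + s) ^4
      + ℚ8 * (p * q * (p * p + q * q) - w * (r * s * (r * r + s * s)))
quartic-difference = solve 5 (λ p q r s w →
  (p :+ q) :^4 :+ w :* (r :- s) :^4
    := (p :- q) :^4 :+ w :* (r :+ s) :^4
       :+ con ℚ8 :* (p :* q :* (p :* p :+ q :* q) :- w :* (r :* s :* (r :* r :+ s :* s)))) refl
  where
  _:^4 : ∀ {k} → Polynomial k → Polynomial k
  x :^4 = x :* x :* x :* x

equal-sums-of-quartics : ∀ p q r s w →
  p * q * (p * p + q * q) ≡ w * (r * s * (r * r + s * s)) →
  (p + q) ^4 + w * (r - s) ^4 ≡ (p - q) ^4 + w * (r + s) ^4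
equal-sums-of-quartics p q r s w L≡wR = begin
  (p + q) ^4 + w * (r - s) ^4         ≡⟨ quartic-difference p q r s w ⟩
  C⁴+wD⁴ + ℚ8 * (L - wR)              ≡⟨ cong (λ e → C⁴+wD⁴ + ℚ8 * (e - wR)) L≡wR ⟩
  C⁴+wD⁴ + ℚ8 * (wR - wR)             ≡⟨ cong (λ e → C⁴+wD⁴ + ℚ8 * e) (ℚ.+-inverseʳ wR) ⟩
  C⁴+wD⁴ + ℚ8 * 0ℚ                    ≡⟨ cong (C⁴+wD⁴ +_) (ℚ.*-zeroʳ ℚ8) ⟩
  C⁴+wD⁴ + 0ℚ                         ≡⟨ ℚ.+-identityʳ C⁴+wD⁴ ⟩
  C⁴+wD⁴                              ∎
  where
  open ≡-Reasoning
  C⁴+wD⁴ L wR : ℚ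
  C⁴+wD⁴ = (p - q) ^4 + w * (r + s) ^4
  L = p * q * (p * p + q * q)
  wR = w * (r * s * (r * r + s * s))

module _ (u : ℚ) where
  open Params u

  private
    pᵖ qᵖ rᵖ sᵖ numᵖ denᵖ Xᵖ : Polynomial 1 → Polynomial 1
    pᵖ x = con ℚ2 :* (x :* x :+ con ℚ1)
    qᵖ x = con ℚ3 :* x
    rᵖ x = con ℚ6 :* x
    sᵖ x = con ℚ2 :* (con ℚ2 :- x :* x)
    numᵖ x = con ℚ4 :* (x :* x) :+ con ℚ1
    denᵖ x = con ℚ8 :* (con ℚ2 :- x :* x)
    Xᵖ x = con ℚ6 :* x :* (x :* x :+ con ℚ1) :* (x :* x :+ con ℚ4)

  X : ℚ
  X = ℚ6 * u * (u * u + ℚ1) * (u * u + ℚ4)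

  pq-factorisation : p * q * (p * p + q * q) ≡ num * X
  pq-factorisation = solve 1 (λ x →
    pᵖ x :* qᵖ x :* (pᵖ x :* pᵖ x :+ qᵖ x :* qᵖ x) := numᵖ x :* Xᵖ x) refl u

  rs-factorisation : r * s * (r * r + s * s) ≡ den * X
  rs-factorisation = solve 1 (λ x →
    rᵖ x :* sᵖ x :* (rᵖ x :* rᵖ x :+ sᵖ x :* sᵖ x) := denᵖ x :* Xᵖ x) refl u

  -- u² = 2 - den/8, so den = 0 would make u a square root of the prime 2.
  den≢0 : den ≢ 0ℚ
  den≢0 den≡0 = square≢prime prime[2] u (begin
    u * u                        ≡⟨ u²≡2-den/8 ⟩
    ℚ2 - ℤ.+ 1 / 8 * den         ≡⟨ cong (λ e → ℚ2 - ℤ.+ 1 / 8 * e) den≡0 ⟩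
    ℚ2 - ℤ.+ 1 / 8 * 0ℚ          ≡⟨⟩
    prime-ℚ 2                    ∎)
    where
    open ≡-Reasoning
    u²≡2-den/8 : u * u ≡ ℚ2 - ℤ.+ 1 / 8 * den
    u²≡2-den/8 = solve 1 (λ x → x :* x := con ℚ2 :- con (ℤ.+ 1 / 8) :* denᵖ x) refl u

mainTheorem16 : (u : ℚ) → Params.Claim u
mainTheorem16 u = den-nonZero , pq≡a·rs , equal-sums-of-quartics p q r s a pq≡a·rs
  where
  open Params u
  den-nonZero : NonZero den
  den-nonZero = ≢-nonZero (den≢0 u)
  instance _ = den-nonZero
  pq≡a·rs : p * q * (p * p + q * q) ≡ a * (r * s * (r * r + s * s))
  pq≡a·rs = begin
    p * q * (p * p + q * q)        ≡⟨ pq-factorisation u ⟩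
    num * X u                      ≡⟨ ÷-rescale num den (X u) ⟩
    a * (den * X u)                ≡⟨ cong (a *_) (rs-factorisation u) ⟨
    a * (r * s * (r * r + s * s))  ∎
    where open ≡-Reasoning
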